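{- If $G$ is a finite simple connected twin-free graph with at least two vertices, then $o(G\circ P_3)=\mathcal{R}$ and $R_{\rm MB}(G\circ P_3)=R_{\rm MB}'(G\circ P_3)=n(G)$.
   Context: $P_n$ is the path on $n$ vertices; $n(G)$ is the number of vertices of $G$. Vertices $u\neq v$ are twins if $N(u)\setminus\{v\}=N(v)\setminus\{u\}$; $G$ is twin-free if it has no pair of twins. The lexicographic product $G\circ H$ has vertex set $V(G)\times V(H)$, with $(g,h)(g',h')$ an edge iff $gg'\in E(G)$, or $g=g'$ and $hh'\in E(H)$. A set $W\subseteq V(X)$ is a resolving set of a connected graph $X$ if for every two distinct vertices $x,y$ there is $z\in W$ with $d(x,z)\ne d(y,z)$. In the Maker-Breaker resolving game on $X$, Resolver and Spoiler alternately select unplayed vertices of $X$; Resolver wins if the vertices he selects contain a resolving set of $X$, and Spoiler wins if she selects at least one vertex of every resolving set of $X$. The R-game has Resolver moving first; the S-game has Spoiler moving first. $o(X)=\mathcal{R}$ means Resolver has a winning strategy no matter who starts. $R_{\rm MB}(X)$ (resp. $R_{\rm MB}'(X)$) is the minimum number of moves Resolver needs to win the R-game (resp. S-game) under optimal play of both players. -}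

module Defs where

open import Data.Nat using (ℕ; zero; suc; _≤_; _*_)
open import Data.Fin using (Fin; zero; suc; remQuot; _≟_)
open import Data.Bool using (Bool; true; false; _∧_; _∨_; if_then_else_)
open import Data.Product using (Σ; ∃; _×_; _,_; proj₁; proj₂)
open import Relation.Binary.PropositionalEquality using (_≡_; _≢_)
open import Relation.Nullary using (¬_)
open import Relation.Nullary.Decidable using (⌊_⌋)

Graph : ℕ → Set
Graph n = Fin n → Fin n → Bool

IsSimple : ∀ {n} → Graph n → Set
IsSimple {n} G = (∀ (x y : Fin n) → G x y ≡ G y x) × (∀ (x : Fin n) → G x x ≡ false)

data Walk {n} (G : Graph n) : Fin n → Fin n → ℕ → Set where
  here : ∀ {x} → Walk G x x 0
  step : ∀ {x y z k} → G x y ≡ true → Walk G y z k → Walk G x z (suc k)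

Connected : ∀ {n} → Graph n → Set
Connected {n} G = ∀ (x y : Fin n) → ∃ λ k → Walk G x y k

IsDist : ∀ {n} → Graph n → Fin n → Fin n → ℕ → Set
IsDist G x y d = Walk G x y d × (∀ k → Walk G x y k → d ≤ k)

Twins : ∀ {n} → Graph n → Fin n → Fin n → Set
Twins {n} G u v = u ≢ v × (∀ (w : Fin n) → w ≢ u → w ≢ v → G u w ≡ G v w)

TwinFree : ∀ {n} → Graph n → Set
TwinFree {n} G = ∀ (u v : Fin n) → ¬ Twins G u v

P3 : Graph 3
P3 zero (suc zero) = true
P3 (suc zero) zero = true
P3 (suc zero) (suc (suc zero)) = true
P3 (suc (suc zero)) (suc zero) = true
P3 _ _ = false

-- lexicographic product G ∘ H on Fin (m * k); vertex i encodes the pair remQuot k i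
-- (the inverse of Data.Fin.combine, a bijection Fin (m * k) ≅ Fin m × Fin k)
lex : ∀ {m k} → Graph m → Graph k → Graph (m * k)
lex {m} {k} G H i j with remQuot {m} k i | remQuot {m} k j
... | g , h | g' , h' = G g g' ∨ (⌊ g ≟ g' ⌋ ∧ H h h')

Resolving : ∀ {n} → Graph n → (Fin n → Bool) → Set
Resolving {n} G W = ∀ (x y : Fin n) → x ≢ y →
  Σ (Fin n) λ z → W z ≡ true × Σ ℕ λ d₁ → Σ ℕ λ d₂ →
    IsDist G x z d₁ × IsDist G y z d₂ × d₁ ≢ d₂

data Owner : Set where
  free resolver spoiler : Owner

Position : ℕ → Set
Position n = Fin n → Owner

start : ∀ {n} → Position n
start _ = free

play : ∀ {n} → Position n → Fin n → Owner → Position n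
play p v o w = if ⌊ w ≟ v ⌋ then o else p w

ResolverHasWon : ∀ {n} → Graph n → Position n → Set
ResolverHasWon {n} X p =
  Σ (Fin n → Bool) λ W → (∀ w → W w ≡ true → p w ≡ resolver) × Resolving X W

mutual
  -- Resolver to move; he can force a win using at most k more of his own moves
  data RWin {n} (X : Graph n) : ℕ → Position n → Set where
    r-done : ∀ {k p} → ResolverHasWon X p → RWin X k p
    r-move : ∀ {k p} (v : Fin n) → p v ≡ free →
             SWin X k (play p v resolver) → RWin X (suc k) p

  -- Spoiler to move; Resolver can force a win using at most k more of his moves
  -- (if not yet won, the board must be non-full, otherwise the game is over and lost)
  data SWin {n} (X : Graph n) : ℕ → Position n → Set where
    s-done : ∀ {k p} → ResolverHasWon X p → SWin X k p
    s-all  : ∀ {k p} (v₀ : Fin n) → p v₀ ≡ free →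
             (∀ (v : Fin n) → p v ≡ free → RWin X k (play p v spoiler)) → SWin X k p

-- o(X) = R : Resolver wins both the R-game and the S-game
OutcomeR : ∀ {n} → Graph n → Set
OutcomeR X = (∃ λ k → RWin X k start) × (∃ λ k → SWin X k start)

RMB≡ : ∀ {n} → Graph n → ℕ → Set
RMB≡ X r = RWin X r start × (∀ k → RWin X k start → r ≤ k)

RMB'≡ : ∀ {n} → Graph n → ℕ → Set
RMB'≡ X r = SWin X r start × (∀ k → SWin X k start → r ≤ k)

{-# OPTIONS --safe #-}
-- In G ∘ P₃ the two ends (g,0) and (g,2) of each copy of P₃ have the same
-- neighbourhood, so every resolving set contains one of them.  Conversely, a set
-- containing an end of every copy resolves G ∘ P₃: two vertices of one copy are
-- separated by an end of that copy, and vertices of copies g ≠ g' by an end of the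
-- copy of a vertex w of G adjacent to exactly one of g, g' (twin-freeness), since
-- across copies adjacency in G ∘ P₃ is adjacency in G.  The game is therefore
-- "claim one vertex of each of n disjoint pairs": answering Spoiler inside the
-- pair she touched wins in n moves whoever starts, and as a Resolver move claims
-- at most one pair, fewer moves never suffice.
module Submission where

open import Defs
open import Data.Bool using (Bool; true; false; not; _∧_; _∨_)
import Data.Bool as B
open import Data.Bool.Properties using (∨-identityʳ; not-¬)
open import Data.Fin using (Fin; zero; suc; combine; _≟_)
open import Data.Fin.Properties
  using (any?; suc-injective; remQuot-combine; combine-remQuot; combine-injective; combine-injectiveˡ; combine-injectiveʳ)
open import Data.Fin.Subset using (Subset; inside; outside; _∈_; _⊆_; ∣_∣; ⊤)
open import Data.Fin.Subset.Properties
  using (nonempty?; Empty-unique; ∣⊥∣≡0; ∣⊤∣≡n; ∣p∣≤n; drop-there; ∣p∣≤∣x∷p∣; p⊆q⇒∣p∣≤∣q∣; p⊂q⇒∣p∣<∣q∣)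
open import Data.Nat using (ℕ; zero; suc; _≤_; _<_; _*_; _≡ᵇ_; z≤n; s≤s)
open import Data.Nat.Properties using (≤-trans; ≤-reflexive; ≤-antisym; ≤-pred; <-≤-trans; m≤n⇒m≤1+n; n≮0)
open import Data.Product using (Σ; ∃; ∃₂; _×_; _,_; proj₁; proj₂; map₂)
open import Data.Sum using (_⊎_; inj₁; inj₂)
import Data.Sum as Sum
open import Data.Vec using (_∷_; tabulate; here; there)
open import Data.Vec.Properties using (lookup∘tabulate; []=⇒lookup; lookup⇒[]=)
open import Function using (_∘_)
open import Function.Bundles using (_⇔_; mk⇔; Equivalence)
open import Level using (Level)
open import Relation.Binary.PropositionalEquality
  using (_≡_; _≢_; module ≡-Reasoning; refl; sym; trans; cong; cong₂; subst; subst₂; ≢-sym)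
open import Relation.Nullary using (¬_; Dec; does; yes; no; contradiction)
open import Relation.Nullary.Decidable using (⌊_⌋; decidable-stable; dec-true; dec-false; _×-dec_; ¬?; map′)
open import Relation.Unary using (Pred; Decidable)

private
  variable
    ℓ : Level
    m N n k d d₁ d₂ : ℕ

Least : Pred ℕ ℓ → Set ℓ
Least P = Σ ℕ λ d → P d × (∀ j → P j → d ≤ j)

least : {P : Pred ℕ ℓ} → Decidable P → P k → Least P
least {k = zero} P? p = 0 , p , λ _ _ → z≤n
least {k = suc k} {P = P} P? p with P? 0
... | yes p₀ = 0 , p₀ , λ _ _ → z≤n
... | no ¬p₀ with least {P = λ j → P (suc j)} (P? ∘ suc) p
...   | d , pd , below = suc d , pd , λ
        { zero p₀ → contradiction p₀ ¬p₀
        ; (suc j) pj → s≤s (below j pj)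
        }

∃-Bool? : {P : Bool → Set ℓ} → Dec (P false) → Dec (P true) → Dec (∃ P)
∃-Bool? (yes p) _ = yes (false , p)
∃-Bool? (no _) (yes p) = yes (true , p)
∃-Bool? (no ¬f) (no ¬t) = no λ { (false , p) → ¬f p ; (true , p) → ¬t p }

p⊆q-except-x⇒∣p∣≤1+∣q∣ : {p q : Subset n} (x : Fin n) → (∀ {y} → y ∈ p → y ≢ x → y ∈ q) →
  ∣ p ∣ ≤ suc ∣ q ∣
p⊆q-except-x⇒∣p∣≤1+∣q∣ {p = inside ∷ p} {t ∷ q} zero p⊆q∪x =
  s≤s (≤-trans (p⊆q⇒∣p∣≤∣q∣ (λ y∈p → drop-there (p⊆q∪x (there y∈p) λ ()))) (∣p∣≤∣x∷p∣ t q))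
p⊆q-except-x⇒∣p∣≤1+∣q∣ {p = outside ∷ p} {t ∷ q} zero p⊆q∪x =
  m≤n⇒m≤1+n (≤-trans (p⊆q⇒∣p∣≤∣q∣ (λ y∈p → drop-there (p⊆q∪x (there y∈p) λ ()))) (∣p∣≤∣x∷p∣ t q))
p⊆q-except-x⇒∣p∣≤1+∣q∣ {p = outside ∷ p} {t ∷ q} (suc x) p⊆q∪x =
  ≤-trans (p⊆q-except-x⇒∣p∣≤1+∣q∣ x (λ y∈p y≢x → drop-there (p⊆q∪x (there y∈p) (y≢x ∘ suc-injective))))
          (s≤s (∣p∣≤∣x∷p∣ t q))
p⊆q-except-x⇒∣p∣≤1+∣q∣ {p = inside ∷ p} {t ∷ q} (suc x) p⊆q∪x with p⊆q∪x here (λ ())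
... | here = s≤s (p⊆q-except-x⇒∣p∣≤1+∣q∣ x (λ y∈p y≢x → drop-there (p⊆q∪x (there y∈p) (y≢x ∘ suc-injective))))

∈-tabulate : {f : Fin n → Bool} {i : Fin n} → i ∈ tabulate f ⇔ f i ≡ true
∈-tabulate {f = f} {i} = mk⇔
  (λ i∈ → trans (sym (lookup∘tabulate f i)) ([]=⇒lookup i∈))
  (λ fi → lookup⇒[]= i _ (trans (lookup∘tabulate f i) fi))

-- Distances and resolving sets

module _ (X : Graph m) where

  walk? : ∀ k x z → Dec (Walk X x z k)
  walk? zero x z = map′ (λ { refl → here }) (λ { here → refl }) (x ≟ z)
  walk? (suc k) x z =
    map′ (λ (y , e , w) → step e w) (λ { (step e w) → _ , e , w })
         (any? λ y → (X x y B.≟ true) ×-dec walk? k y z)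

  distance : Connected X → ∀ x z → Σ ℕ (IsDist X x z)
  distance connected x z = least (λ j → walk? j x z) (proj₂ (connected x z))

  -- Resolving X W unfolds to ∀ x y → x ≢ y → Σ z (W z ≡ true × Separates z x y).
  Separates : Fin m → Fin m → Fin m → Set
  Separates z x y = Σ ℕ λ d₁ → Σ ℕ λ d₂ → IsDist X x z d₁ × IsDist X y z d₂ × d₁ ≢ d₂

  separates-sym : ∀ {z x y} → Separates z y x → Separates z x y
  separates-sym (d₂ , d₁ , D₂ , D₁ , d₂≢d₁) = d₁ , d₂ , D₁ , D₂ , ≢-sym d₂≢d₁

  self-separates : Connected X → ∀ {x y} → x ≢ y → Separates x x y
  self-separates connected {x} {y} x≢y with distance connected y x
  ... | d , D = 0 , d , (here , λ _ _ → z≤n) , D , 0≢d D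
    where
    0≢d : ∀ {d} → IsDist X y x d → 0 ≢ d
    0≢d (here , _) refl = x≢y refl

  adjacency-by-distance : ∀ {x z} → x ≢ z → IsDist X x z d → X x z ≡ (d ≡ᵇ 1)
  adjacency-by-distance x≢z (here , _) = contradiction refl x≢z
  adjacency-by-distance _ (step e here , _) = e
  adjacency-by-distance {x = x} {z} _ (step _ (step _ _) , shortest) with X x z in e
  ... | false = refl
  ... | true with shortest 1 (step e here)
  ...   | s≤s ()

  adjacency-separates : Connected X → ∀ {x y z} → x ≢ z → y ≢ z → X x z ≢ X y z → Separates z x y
  adjacency-separates connected {x} {y} {z} x≢z y≢z differ with distance connected x z | distance connected y z
  ... | d₁ , D₁ | d₂ , D₂ = d₁ , d₂ , D₁ , D₂ , λ d₁≡d₂ → differ (begin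
    X x z      ≡⟨ adjacency-by-distance x≢z D₁ ⟩
    d₁ ≡ᵇ 1    ≡⟨ cong (_≡ᵇ 1) d₁≡d₂ ⟩
    d₂ ≡ᵇ 1    ≡⟨ adjacency-by-distance y≢z D₂ ⟨
    X y z      ∎)
    where
    open ≡-Reasoning

  twin-distance-≤ : ∀ {x y z} → z ≢ x → (∀ w → X x w ≡ X y w) →
    IsDist X x z d₁ → IsDist X y z d₂ → d₂ ≤ d₁
  twin-distance-≤ z≢x _ (here , _) _ = contradiction refl z≢x
  twin-distance-≤ _ same (step e w , _) (_ , shortest) = shortest _ (step (trans (sym (same _)) e) w)

  resolving-meets-twins : ∀ {W x y} → x ≢ y → (∀ w → X x w ≡ X y w) → Resolving X W →
    W x ≡ true ⊎ W y ≡ true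
  resolving-meets-twins {x = x} {y} x≢y same resolving with resolving x y x≢y
  ... | z , Wz , _ , _ , D₁ , D₂ , d₁≢d₂ with z ≟ x | z ≟ y
  ...   | yes refl | _ = inj₁ Wz
  ...   | no _ | yes refl = inj₂ Wz
  ...   | no z≢x | no z≢y = contradiction
          (≤-antisym (twin-distance-≤ z≢y (sym ∘ same) D₂ D₁) (twin-distance-≤ z≢x same D₁ D₂)) d₁≢d₂

twin-free⇒distinguishing : {G : Graph n} → TwinFree G → ∀ {g g'} → g ≢ g' →
  ∃ λ w → w ≢ g × w ≢ g' × G g w ≢ G g' w
twin-free⇒distinguishing {G = G} twin-free {g} {g'} g≢g'
  with any? (λ w → ¬? (w ≟ g) ×-dec ¬? (w ≟ g') ×-dec ¬? (G g w B.≟ G g' w))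
... | yes found = found
... | no none = contradiction (g≢g' , λ w w≢g w≢g' →
        decidable-stable (G g w B.≟ G g' w) (λ differ → none (w , w≢g , w≢g' , differ))) (twin-free g g')

-- Pairing strategies in the resolving game

play-≡ : (p : Position N) (v : Fin N) (o : Owner) → play p v o v ≡ o
play-≡ p v o with v ≟ v
... | yes _ = refl
... | no v≢v = contradiction refl v≢v

play-≢ : (p : Position N) {v w : Fin N} (o : Owner) → w ≢ v → play p v o w ≡ p w
play-≢ p {v} {w} o w≢v with w ≟ v
... | yes w≡v = contradiction w≡v w≢v
... | no _ = refl

resolver? : (o : Owner) → Dec (o ≡ resolver)
resolver? free = no λ ()
resolver? resolver = yes refl
resolver? spoiler = no λ ()

selection : Position N → Fin N → Bool
selection p w = does (resolver? (p w))

selection-sound : (p : Position N) (w : Fin N) → selection p w ≡ true → p w ≡ resolver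
selection-sound p w with resolver? (p w)
... | yes owned = λ _ → owned
... | no _ = λ ()

record _⊑_ (p q : Position N) : Set where
  field
    kept : ∀ w → p w ≡ resolver → q w ≡ resolver
open _⊑_

⊑-play-resolver : (p : Position N) (v : Fin N) → p ⊑ play p v resolver
⊑-play-resolver p v .kept w pw with w ≟ v
... | yes _ = refl
... | no _ = pw

⊑-play-spoiler : (p : Position N) (v : Fin N) → p v ≡ free → p ⊑ play p v spoiler
⊑-play-spoiler p v pv .kept w pw with w ≟ v
... | yes refl = contradiction (trans (sym pw) pv) λ ()
... | no _ = pw

play-spoiler-⊑ : (p : Position N) (v : Fin N) → play p v spoiler ⊑ p
play-spoiler-⊑ p v .kept w pw with w ≟ v
... | yes _ = contradiction pw λ ()
... | no _ = pw

Transversal : (Fin n → Bool → Fin N) → (Fin N → Bool) → Set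
Transversal cell W = ∀ i → ∃ λ s → W (cell i s) ≡ true

module PairingStrategy (X : Graph N) (cell : Fin n → Bool → Fin N)
  (cell-injective : ∀ {i j s t} → cell i s ≡ cell j t → i ≡ j × s ≡ t)
  (resolving⇔transversal : ∀ W → Resolving X W ⇔ Transversal cell W) where

  record Claimed (p : Position N) (i : Fin n) : Set where
    constructor claimed-at
    field
      side : Bool
      owned : p (cell i side) ≡ resolver

  record Open (p : Position N) (i : Fin n) : Set where
    constructor both-free
    field
      unplayed : ∀ s → p (cell i s) ≡ free
  open Open

  Safe : Position N → Set
  Safe p = ∀ i → Claimed p i ⊎ Open p i

  Open⇒¬Claimed : ∀ {p i} → Open p i → ¬ Claimed p i
  Open⇒¬Claimed vacant (claimed-at s owned) = contradiction (trans (sym (unplayed vacant s)) owned) λ ()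

  Claimed-mono : ∀ {p q i} → p ⊑ q → Claimed p i → Claimed q i
  Claimed-mono p⊑q (claimed-at s owned) = claimed-at s (kept p⊑q _ owned)

  Claimed-play⁻ : ∀ {p v o j} → (∀ t → cell j t ≢ v) → Claimed (play p v o) j → Claimed p j
  Claimed-play⁻ {p} {o = o} away (claimed-at t owned) = claimed-at t (trans (sym (play-≢ p o (away t))) owned)

  cells-apart : ∀ {i j s t} → j ≢ i → cell j t ≢ cell i s
  cells-apart j≢i = j≢i ∘ proj₁ ∘ cell-injective

  Open-play : ∀ {p j v o} → (∀ t → cell j t ≢ v) → Open p j → Open (play p v o) j
  Open-play {p} {o = o} away vacant = both-free λ t → trans (play-≢ p o (away t)) (unplayed vacant t)

  status-kept : ∀ {p v o j} → p ⊑ play p v o → (Open p j → ∀ t → cell j t ≢ v) →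
    Claimed p j ⊎ Open p j → Claimed (play p v o) j ⊎ Open (play p v o) j
  status-kept extends away = Sum.map (Claimed-mono extends) (λ vacant → Open-play (away vacant) vacant)

  won⇔all-claimed : ∀ {p} → ResolverHasWon X p ⇔ (∀ i → Claimed p i)
  won⇔all-claimed {p} = mk⇔ claimed-by-winner winning-selection
    where
    claimed-by-winner : ResolverHasWon X p → ∀ i → Claimed p i
    claimed-by-winner (W , owned , resolving) i with Equivalence.to (resolving⇔transversal W) resolving i
    ... | s , Ws = claimed-at s (owned _ Ws)

    winning-selection : (∀ i → Claimed p i) → ResolverHasWon X p
    winning-selection all = selection p , selection-sound p ,
      Equivalence.from (resolving⇔transversal (selection p))
        (λ i → Claimed.side (all i) , dec-true (resolver? _) (Claimed.owned (all i)))

  claimed? : ∀ p i → Dec (Claimed p i)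
  claimed? p i = map′ (λ (s , owned) → claimed-at s owned) (λ (claimed-at s owned) → s , owned)
    (∃-Bool? (resolver? (p (cell i false))) (resolver? (p (cell i true))))

  -- ∣ unclaimed p ∣ is exactly the number of moves Resolver still needs from p.
  unclaimed : Position N → Subset n
  unclaimed p = tabulate (not ∘ does ∘ claimed? p)

  ∈-unclaimed⁺ : ∀ {p i} → ¬ Claimed p i → i ∈ unclaimed p
  ∈-unclaimed⁺ {p} {i} ¬claimed = Equivalence.from ∈-tabulate (cong not (dec-false (claimed? p i) ¬claimed))

  ∈-unclaimed⁻ : ∀ {p i} → i ∈ unclaimed p → ¬ Claimed p i
  ∈-unclaimed⁻ {p} {i} i∈ claimed =
    contradiction (trans (sym (Equivalence.to ∈-tabulate i∈)) (cong not (dec-true (claimed? p i) claimed))) λ ()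

  unclaimed-antitone : ∀ {p q} → p ⊑ q → unclaimed q ⊆ unclaimed p
  unclaimed-antitone p⊑q i∈ = ∈-unclaimed⁺ (∈-unclaimed⁻ i∈ ∘ Claimed-mono p⊑q)

  ∣unclaimed∣-antitone : ∀ {p q} → p ⊑ q → ∣ unclaimed q ∣ ≤ ∣ unclaimed p ∣
  ∣unclaimed∣-antitone = p⊆q⇒∣p∣≤∣q∣ ∘ unclaimed-antitone

  ∣unclaimed∣≡0 : ∀ {p} → (∀ i → Claimed p i) → ∣ unclaimed p ∣ ≡ 0
  ∣unclaimed∣≡0 all = trans (cong ∣_∣ (Empty-unique λ (i , i∈) → ∈-unclaimed⁻ i∈ (all i))) (∣⊥∣≡0 n)

  ∣unclaimed-start∣ : ∣ unclaimed start ∣ ≡ n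
  ∣unclaimed-start∣ = ≤-antisym (∣p∣≤n (unclaimed start)) (subst (_≤ ∣ unclaimed start ∣) (∣⊤∣≡n n)
    (p⊆q⇒∣p∣≤∣q∣ {p = ⊤} λ _ → ∈-unclaimed⁺ {start} λ { (claimed-at _ ()) }))

  cell? : ∀ v → Dec (∃₂ λ i s → cell i s ≡ v)
  cell? v = any? λ i → ∃-Bool? (cell i false ≟ v) (cell i true ≟ v)

  all-claimed-or-open : ∀ {p} → Safe p → (∀ i → Claimed p i) ⊎ ∃ (Open p)
  all-claimed-or-open {p} safe with nonempty? (unclaimed p)
  ... | no empty = inj₁ λ i → decidable-stable (claimed? p i) (λ ¬claimed → empty (i , ∈-unclaimed⁺ ¬claimed))
  ... | yes (i , i∈) with safe i
  ...   | inj₁ claimed = contradiction claimed (∈-unclaimed⁻ i∈)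
  ...   | inj₂ vacant = inj₂ (i , vacant)

  claim-keeps-safe : ∀ {p i} s → (∀ j → j ≢ i → Claimed p j ⊎ Open p j) → Safe (play p (cell i s) resolver)
  claim-keeps-safe {p} {i} s safe-elsewhere j with j ≟ i
  ... | yes refl = inj₁ (claimed-at s (play-≡ p (cell i s) resolver))
  ... | no j≢i = status-kept (⊑-play-resolver p _) (λ _ _ → cells-apart j≢i) (safe-elsewhere j j≢i)

  claim-shrinks : ∀ {p i} s → ¬ Claimed p i → ∣ unclaimed (play p (cell i s) resolver) ∣ < ∣ unclaimed p ∣
  claim-shrinks {p} {i} s ¬claimed = p⊂q⇒∣p∣<∣q∣
    (unclaimed-antitone (⊑-play-resolver p (cell i s)) , i , ∈-unclaimed⁺ ¬claimed ,
     λ i∈ → ∈-unclaimed⁻ {play p (cell i s) resolver} i∈ (claimed-at s (play-≡ p (cell i s) resolver)))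

  spoiler-keeps-safe : ∀ {p v} → Safe p → p v ≡ free → (∀ j → Open p j → ∀ t → cell j t ≢ v) →
    Safe (play p v spoiler)
  spoiler-keeps-safe {p} {v} safe v-free away j = status-kept (⊑-play-spoiler p v v-free) (away j) (safe j)

  mutual
    resolver-wins : ∀ {k p} → Safe p → ∣ unclaimed p ∣ ≤ k → RWin X k p
    resolver-wins safe bound with all-claimed-or-open safe
    ... | inj₁ all = r-done (Equivalence.from won⇔all-claimed all)
    ... | inj₂ (i , vacant) = claim false (λ j _ → safe j) (Open⇒¬Claimed vacant) (unplayed vacant false) bound

    spoiler-loses : ∀ {k p} → Safe p → ∣ unclaimed p ∣ ≤ k → SWin X k p
    spoiler-loses safe bound with all-claimed-or-open safe
    ... | inj₁ all = s-done (Equivalence.from won⇔all-claimed all)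
    ... | inj₂ (i , vacant) = s-all (cell i false) (unplayed vacant false) λ _ v-free → respond safe bound v-free

    claim : ∀ {k p i} s → (∀ j → j ≢ i → Claimed p j ⊎ Open p j) → ¬ Claimed p i →
      p (cell i s) ≡ free → ∣ unclaimed p ∣ ≤ k → RWin X k p
    claim {zero} s _ ¬claimed _ bound = contradiction (<-≤-trans (claim-shrinks s ¬claimed) bound) n≮0
    claim {suc k} s safe-elsewhere ¬claimed cell-free bound = r-move _ cell-free
      (spoiler-loses (claim-keeps-safe s safe-elsewhere) (≤-pred (<-≤-trans (claim-shrinks s ¬claimed) bound)))

    respond : ∀ {k p v} → Safe p → ∣ unclaimed p ∣ ≤ k → p v ≡ free → RWin X k (play p v spoiler)
    respond {p = p} {v} safe bound v-free
      with cell? v | ≤-trans (∣unclaimed∣-antitone (⊑-play-spoiler p v v-free)) bound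
    ... | no not-cell | bound′ =
          resolver-wins (spoiler-keeps-safe safe v-free λ j _ t e → not-cell (j , t , e)) bound′
    ... | yes (i , s , refl) | bound′ with safe i
    ...   | inj₁ claimed = resolver-wins
            (spoiler-keeps-safe safe v-free λ j vacant t e →
              Open⇒¬Claimed vacant (subst (Claimed p) (sym (proj₁ (cell-injective e))) claimed))
            bound′
    ...   | inj₂ vacant = claim (not s)
            (λ j j≢i → status-kept (⊑-play-spoiler p v v-free) (λ _ _ → cells-apart j≢i) (safe j))
            (Open⇒¬Claimed vacant ∘ Claimed-mono (play-spoiler-⊑ p v))
            (trans (play-≢ p spoiler (not-¬ refl ∘ sym ∘ proj₂ ∘ cell-injective)) (unplayed vacant (not s)))
            bound′

  resolver-claims-at-most-one : ∀ p v → ∣ unclaimed p ∣ ≤ suc ∣ unclaimed (play p v resolver) ∣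
  resolver-claims-at-most-one p v with cell? v
  ... | no not-cell = m≤n⇒m≤1+n (p⊆q⇒∣p∣≤∣q∣ λ j∈ →
          ∈-unclaimed⁺ {play p v resolver} (∈-unclaimed⁻ j∈ ∘ Claimed-play⁻ λ t e → not-cell (_ , t , e)))
  ... | yes (i , s , refl) = p⊆q-except-x⇒∣p∣≤1+∣q∣ i λ j∈ j≢i →
          ∈-unclaimed⁺ {play p v resolver} (∈-unclaimed⁻ j∈ ∘ Claimed-play⁻ λ _ → cells-apart j≢i)

  won⇒∣unclaimed∣≤ : ∀ {k p} → ResolverHasWon X p → ∣ unclaimed p ∣ ≤ k
  won⇒∣unclaimed∣≤ won = ≤-trans (≤-reflexive (∣unclaimed∣≡0 (Equivalence.to won⇔all-claimed won))) z≤n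

  mutual
    RWin⇒∣unclaimed∣≤ : ∀ {k p} → RWin X k p → ∣ unclaimed p ∣ ≤ k
    RWin⇒∣unclaimed∣≤ (r-done won) = won⇒∣unclaimed∣≤ won
    RWin⇒∣unclaimed∣≤ {p = p} (r-move v _ next) =
      ≤-trans (resolver-claims-at-most-one p v) (s≤s (SWin⇒∣unclaimed∣≤ next))

    SWin⇒∣unclaimed∣≤ : ∀ {k p} → SWin X k p → ∣ unclaimed p ∣ ≤ k
    SWin⇒∣unclaimed∣≤ (s-done won) = won⇒∣unclaimed∣≤ won
    SWin⇒∣unclaimed∣≤ {p = p} (s-all v v-free next) =
      ≤-trans (∣unclaimed∣-antitone (play-spoiler-⊑ p v)) (RWin⇒∣unclaimed∣≤ (next v v-free))

  pairing-strategy : OutcomeR X × RMB≡ X n × RMB'≡ X n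
  pairing-strategy =
    ((n , r-game) , (n , s-game)) ,
    (r-game , λ k → subst (_≤ k) ∣unclaimed-start∣ ∘ RWin⇒∣unclaimed∣≤) ,
    (s-game , λ k → subst (_≤ k) ∣unclaimed-start∣ ∘ SWin⇒∣unclaimed∣≤)
    where
    start-safe : Safe start
    start-safe _ = inj₂ (both-free λ _ → refl)

    r-game : RWin X n start
    r-game = resolver-wins start-safe (≤-reflexive ∣unclaimed-start∣)

    s-game : SWin X n start
    s-game = spoiler-loses start-safe (≤-reflexive ∣unclaimed-start∣)

-- The lexicographic product with P₃

endpoint : Bool → Fin 3
endpoint false = zero
endpoint true = suc (suc zero)

endpoint-injective : ∀ {s t} → endpoint s ≡ endpoint t → s ≡ t
endpoint-injective {false} {false} _ = refl
endpoint-injective {true} {true} _ = refl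

P3-endpoints-twins : ∀ h → P3 (endpoint false) h ≡ P3 (endpoint true) h
P3-endpoints-twins zero = refl
P3-endpoints-twins (suc zero) = refl
P3-endpoints-twins (suc (suc zero)) = refl

P3-connected : Connected P3
P3-connected zero zero = 0 , here
P3-connected zero (suc zero) = 1 , step refl here
P3-connected zero (suc (suc zero)) = 2 , step {y = suc zero} refl (step refl here)
P3-connected (suc zero) zero = 1 , step refl here
P3-connected (suc zero) (suc zero) = 0 , here
P3-connected (suc zero) (suc (suc zero)) = 1 , step refl here
P3-connected (suc (suc zero)) zero = 2 , step {y = suc zero} refl (step refl here)
P3-connected (suc (suc zero)) (suc zero) = 1 , step refl here
P3-connected (suc (suc zero)) (suc (suc zero)) = 0 , here

P3-endpoint-separates : ∀ s {h h'} → h ≢ endpoint s → h' ≢ endpoint s → h ≢ h' →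
  P3 h (endpoint s) ≢ P3 h' (endpoint s)
P3-endpoint-separates false {zero} h≢e _ _ = contradiction refl h≢e
P3-endpoint-separates false {_} {zero} _ h'≢e _ = contradiction refl h'≢e
P3-endpoint-separates false {suc zero} {suc zero} _ _ h≢h' = contradiction refl h≢h'
P3-endpoint-separates false {suc zero} {suc (suc zero)} _ _ _ = λ ()
P3-endpoint-separates false {suc (suc zero)} {suc zero} _ _ _ = λ ()
P3-endpoint-separates false {suc (suc zero)} {suc (suc zero)} _ _ h≢h' = contradiction refl h≢h'
P3-endpoint-separates true {suc (suc zero)} h≢e _ _ = contradiction refl h≢e
P3-endpoint-separates true {_} {suc (suc zero)} _ h'≢e _ = contradiction refl h'≢e
P3-endpoint-separates true {zero} {zero} _ _ h≢h' = contradiction refl h≢h'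
P3-endpoint-separates true {zero} {suc zero} _ _ _ = λ ()
P3-endpoint-separates true {suc zero} {zero} _ _ _ = λ ()
P3-endpoint-separates true {suc zero} {suc zero} _ _ h≢h' = contradiction refl h≢h'

module LexicographicP3 (G : Graph n) (irreflexive : ∀ g → G g g ≡ false) where

  L : Graph (n * 3)
  L = lex G P3

  data Coordinates : Fin (n * 3) → Set where
    ⟨_,_⟩ : (g : Fin n) (h : Fin 3) → Coordinates (combine g h)

  coordinates : ∀ v → Coordinates v
  coordinates v = subst Coordinates (combine-remQuot {n} 3 v) ⟨ _ , _ ⟩

  lex-combine : ∀ g h g' h' → L (combine g h) (combine g' h') ≡ G g g' ∨ (⌊ g ≟ g' ⌋ ∧ P3 h h')
  lex-combine g h g' h' = cong₂ adjacency (remQuot-combine {n} {3} g h) (remQuot-combine {n} {3} g' h')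
    where
    adjacency : Fin n × Fin 3 → Fin n × Fin 3 → Bool
    adjacency (g , h) (g' , h') = G g g' ∨ (⌊ g ≟ g' ⌋ ∧ P3 h h')

  lex-fibre : ∀ g h h' → L (combine g h) (combine g h') ≡ P3 h h'
  lex-fibre g h h' rewrite lex-combine g h g h' | irreflexive g with g ≟ g
  ... | yes _ = refl
  ... | no g≢g = contradiction refl g≢g

  lex-across : ∀ {g g'} h h' → g ≢ g' → L (combine g h) (combine g' h') ≡ G g g'
  lex-across {g} {g'} h h' g≢g' rewrite lex-combine g h g' h' with g ≟ g'
  ... | yes g≡g' = contradiction g≡g' g≢g'
  ... | no _ = ∨-identityʳ (G g g')

  lex-adjacent : ∀ {g g'} h h' → G g g' ≡ true → L (combine g h) (combine g' h') ≡ true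
  lex-adjacent {g} {g'} h h' adjacent rewrite lex-combine g h g' h' | adjacent = refl

  walk-in-fibre : ∀ {g h h' k} → Walk P3 h h' k → Walk L (combine g h) (combine g h') k
  walk-in-fibre here = here
  walk-in-fibre {g} (step adjacent w) = step (trans (lex-fibre g _ _) adjacent) (walk-in-fibre w)

  walk-across : ∀ {g g' k} → Walk G g g' (suc k) → ∀ h h' → Walk L (combine g h) (combine g' h') (suc k)
  walk-across (step adjacent here) h h' = step (lex-adjacent h h' adjacent) here
  walk-across (step adjacent w@(step _ _)) h h' = step (lex-adjacent h h' adjacent) (walk-across w h' h')

  lex-connected : Connected G → Connected L
  lex-connected connected x z with coordinates x | coordinates z
  ... | ⟨ g , h ⟩ | ⟨ g' , h' ⟩ with g ≟ g' | connected g g'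
  ...   | yes refl | _ = map₂ walk-in-fibre (P3-connected h h')
  ...   | no g≢g' | zero , here = contradiction refl g≢g'
  ...   | no _ | suc k , w = suc k , walk-across w h h'

  cell : Fin n → Bool → Fin (n * 3)
  cell g s = combine g (endpoint s)

  cell-injective : ∀ {g g' s t} → cell g s ≡ cell g' t → g ≡ g' × s ≡ t
  cell-injective {g} {g'} e = map₂ endpoint-injective (combine-injective g _ g' _ e)

  cell-endpoints-distinct : ∀ g → cell g false ≢ cell g true
  cell-endpoints-distinct g e with proj₂ (cell-injective e)
  ... | ()

  cell-endpoints-twins : ∀ g w → L (cell g false) w ≡ L (cell g true) w
  cell-endpoints-twins g w with coordinates w
  ... | ⟨ g' , h' ⟩ rewrite lex-combine g (endpoint false) g' h' | lex-combine g (endpoint true) g' h'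
                          | P3-endpoints-twins h' = refl

  resolving⇒transversal : ∀ W → Resolving L W → Transversal cell W
  resolving⇒transversal W resolving g
    with resolving-meets-twins L (cell-endpoints-distinct g) (cell-endpoints-twins g) resolving
  ... | inj₁ first∈W = false , first∈W
  ... | inj₂ second∈W = true , second∈W

  fibre-separates : Connected G → ∀ {g} s {h h'} → h ≢ h' →
    Separates L (cell g s) (combine g h) (combine g h')
  fibre-separates connected {g} s {h} {h'} h≢h' with h ≟ endpoint s | h' ≟ endpoint s
  ... | yes refl | _ = self-separates L (lex-connected connected) (h≢h' ∘ combine-injectiveʳ g _ g _)
  ... | no _ | yes refl =
          separates-sym L (self-separates L (lex-connected connected) (h≢h' ∘ sym ∘ combine-injectiveʳ g _ g _))
  ... | no h≢e | no h'≢e = adjacency-separates L (lex-connected connected)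
          (h≢e ∘ combine-injectiveʳ g _ g _) (h'≢e ∘ combine-injectiveʳ g _ g _)
          (subst₂ _≢_ (sym (lex-fibre g h (endpoint s))) (sym (lex-fibre g h' (endpoint s)))
            (P3-endpoint-separates s h≢e h'≢e h≢h'))

  across-separates : Connected G → ∀ {g g' w} s h h' → w ≢ g → w ≢ g' → G g w ≢ G g' w →
    Separates L (cell w s) (combine g h) (combine g' h')
  across-separates connected s h h' w≢g w≢g' differ = adjacency-separates L (lex-connected connected)
    (w≢g ∘ sym ∘ combine-injectiveˡ _ _ _ _) (w≢g' ∘ sym ∘ combine-injectiveˡ _ _ _ _)
    (subst₂ _≢_ (sym (lex-across h (endpoint s) (≢-sym w≢g))) (sym (lex-across h' (endpoint s) (≢-sym w≢g')))
      differ)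

  transversal⇒resolving : Connected G → TwinFree G → ∀ W → Transversal cell W → Resolving L W
  transversal⇒resolving connected twin-free W hits x y x≢y with coordinates x | coordinates y
  ... | ⟨ g , h ⟩ | ⟨ g' , h' ⟩ with g ≟ g'
  ...   | yes refl with hits g
  ...     | s , Ws = cell g s , Ws , fibre-separates connected s (x≢y ∘ cong (combine g))
  transversal⇒resolving connected twin-free W hits x y x≢y | ⟨ g , h ⟩ | ⟨ g' , h' ⟩ | no g≢g'
    with twin-free⇒distinguishing twin-free g≢g'
  ... | w , w≢g , w≢g' , differ with hits w
  ...   | s , Ws = cell w s , Ws , across-separates connected s h h' w≢g w≢g' differ

theorem5p1 : (n : ℕ) (G : Graph n) → 2 ≤ n → IsSimple G → Connected G → TwinFree G →
    OutcomeR (lex G P3) × RMB≡ (lex G P3) n × RMB'≡ (lex G P3) n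
theorem5p1 n G _ (_ , irreflexive) connected twin-free = pairing-strategy
  where
  open LexicographicP3 G irreflexive
  open PairingStrategy L cell cell-injective
    (λ W → mk⇔ (resolving⇒transversal W) (transversal⇒resolving connected twin-free W))
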